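{- For all types $A_1$ and $A_2$, the type $[[A_1],[A_2]]$ is atomic.
   Context: Simply typed $\lambda$-calculus over base type $0$; every type is uniquely $[B_1,\dots,B_m]:=B_1\to\cdots\to B_m\to0$; $1:=[0]$. A context $\Gamma=x_1^{C_1},\dots,x_k^{C_k}$ is a finite list of distinct typed variables, $\{\Gamma\}$ its set, $[\Gamma]:=[C_1,\dots,C_k]$; terms identified up to $\beta\eta$ ($=_{\beta\eta}$); $\Lambda^\Xi(A)$ = terms of type $A$ with free variables in $\{\Xi\}$. A substitution $\varrho$ from $\Gamma$ to $\Delta$ assigns $\varrho_c\in\Lambda^\Delta(C)$ to each $c^C\in\{\Gamma\}$; for a fresh context $\Xi$, $\varrho^\Xi$ is $\varrho$ on $\{\Gamma\}$ and the identity on $\{\Xi\}$. $\varrho$ is an atomic reduction if for every fresh $\Xi$, all $a^A,b^B\in\{\Xi,\Gamma\}$ with $A\equiv[A_1,\dots,A_n]$, $B\equiv[B_1,\dots,B_m]$, and all $M_i\in\Lambda^{\Xi,\Delta}(A_i)$, $N_i\in\Lambda^{\Xi,\Delta}(B_i)$: $\varrho^\Xi_aM_1\cdots M_n=_{\beta\eta}\varrho^\Xi_bN_1\cdots N_m$ implies $a=b$ and all $M_i=N_i$. For types, $[\Gamma]\le^a[\Delta]$ means an atomic reduction from the context $\Gamma$ to the context $\Delta$ exists. A type $A$ is atomic if $[1,1]\le^a A$. -}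

module Defs where

open import Data.List using (List; []; _∷_; _++_)
open import Data.List.Relation.Unary.All using (All; []; _∷_)
open import Data.Product using (Σ)

-- Simple types over the base type 0.  Every type is uniquely
-- [B₁,…,Bₘ] := B₁ → ⋯ → Bₘ → 0, represented as  ty (B₁ ∷ ⋯ ∷ Bₘ ∷ []).
data Ty : Set where
  ty : List Ty → Ty

o : Ty
o = ty []

one : Ty
one = ty (o ∷ [])

-- Contexts (de Bruijn): the list of types C₁,…,Cₖ; [Γ] := ty Γ.
Ctx : Set
Ctx = List Ty

infix 4 _∋_
data _∋_ : Ctx → Ty → Set where
  Z : ∀ {Γ A} → (A ∷ Γ) ∋ A
  S : ∀ {Γ A B} → Γ ∋ A → (B ∷ Γ) ∋ A

data Tm (Γ : Ctx) : Ty → Set where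
  var : ∀ {A} → Γ ∋ A → Tm Γ A
  lam : ∀ {A Bs} → Tm (A ∷ Γ) (ty Bs) → Tm Γ (ty (A ∷ Bs))
  app : ∀ {A Bs} → Tm Γ (ty (A ∷ Bs)) → Tm Γ A → Tm Γ (ty Bs)

Ren : Ctx → Ctx → Set
Ren Γ Δ = ∀ {A} → Γ ∋ A → Δ ∋ A

extR : ∀ {Γ Δ B} → Ren Γ Δ → Ren (B ∷ Γ) (B ∷ Δ)
extR ρ Z = Z
extR ρ (S x) = S (ρ x)

rename : ∀ {Γ Δ} → Ren Γ Δ → ∀ {A} → Tm Γ A → Tm Δ A
rename ρ (var x) = var (ρ x)
rename ρ (lam t) = lam (rename (extR ρ) t)
rename ρ (app t u) = app (rename ρ t) (rename ρ u)

Sub : Ctx → Ctx → Set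
Sub Γ Δ = ∀ {A} → Γ ∋ A → Tm Δ A

exts : ∀ {Γ Δ B} → Sub Γ Δ → Sub (B ∷ Γ) (B ∷ Δ)
exts σ Z = var Z
exts σ (S x) = rename S (σ x)

subst : ∀ {Γ Δ} → Sub Γ Δ → ∀ {A} → Tm Γ A → Tm Δ A
subst σ (var x) = σ x
subst σ (lam t) = lam (subst (exts σ) t)
subst σ (app t u) = app (subst σ t) (subst σ u)

single : ∀ {Γ B} → Tm Γ B → Sub (B ∷ Γ) Γ
single u Z = u
single u (S x) = var x

infix 4 _≈_
data _≈_ {Γ : Ctx} : ∀ {A} → Tm Γ A → Tm Γ A → Set where
  ≈-refl  : ∀ {A} {t : Tm Γ A} → t ≈ t
  ≈-sym   : ∀ {A} {t u : Tm Γ A} → t ≈ u → u ≈ t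
  ≈-trans : ∀ {A} {t u v : Tm Γ A} → t ≈ u → u ≈ v → t ≈ v
  ≈-lam   : ∀ {A Bs} {t u : Tm (A ∷ Γ) (ty Bs)} → t ≈ u → lam t ≈ lam u
  ≈-app   : ∀ {A Bs} {t t' : Tm Γ (ty (A ∷ Bs))} {u u' : Tm Γ A} →
            t ≈ t' → u ≈ u' → app t u ≈ app t' u'
  ≈-β     : ∀ {A Bs} (t : Tm (A ∷ Γ) (ty Bs)) (u : Tm Γ A) →
            app (lam t) u ≈ subst (single u) t
  ≈-η     : ∀ {A Bs} (t : Tm Γ (ty (A ∷ Bs))) →
            t ≈ lam (app (rename S t) (var Z))

Args : Ctx → List Ty → Set
Args Γ As = All (Tm Γ) As

apps : ∀ {Γ As} → Tm Γ (ty As) → Args Γ As → Tm Γ o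
apps t [] = t
apps t (M ∷ Ms) = apps (app t M) Ms

-- Equality of variables (possibly a priori of different types): a = b.
data VarEq {Γ : Ctx} : ∀ {A B} → Γ ∋ A → Γ ∋ B → Set where
  same : ∀ {A} {x : Γ ∋ A} → VarEq x x

data ArgsEq {Γ : Ctx} : ∀ {As Bs} → Args Γ As → Args Γ Bs → Set where
  []  : ArgsEq [] []
  _∷_ : ∀ {A As Bs} {M N : Tm Γ A} {Ms : Args Γ As} {Ns : Args Γ Bs} →
        M ≈ N → ArgsEq Ms Ns → ArgsEq (M ∷ Ms) (N ∷ Ns)

extend : ∀ (Ξ : Ctx) {Γ Δ} → Sub Γ Δ → Sub (Ξ ++ Γ) (Ξ ++ Δ)
extend [] ϱ = ϱ
extend (X ∷ Ξ) ϱ = exts (extend Ξ ϱ)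

AtomicReduction : ∀ {Γ Δ} → Sub Γ Δ → Set
AtomicReduction {Γ} {Δ} ϱ =
  ∀ (Ξ : Ctx) {As Bs} (a : (Ξ ++ Γ) ∋ ty As) (b : (Ξ ++ Γ) ∋ ty Bs)
    (Ms : Args (Ξ ++ Δ) As) (Ns : Args (Ξ ++ Δ) Bs) →
    apps (extend Ξ ϱ a) Ms ≈ apps (extend Ξ ϱ b) Ns →
    Σ (VarEq a b) (λ _ → ArgsEq Ms Ns)

infix 4 _≤ᵃ_
_≤ᵃ_ : Ty → Ty → Set
ty Γ ≤ᵃ ty Δ = Σ (Sub Γ Δ) AtomicReduction

Atomic : Ty → Set
Atomic A = ty (one ∷ one ∷ []) ≤ᵃ A

-- Send the two variables of type 1 to  λz. f (λ⃗. z)  and  λz. g (λ⃗. z),  where f : [[A₁]],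
-- g : [[A₂]] and λ⃗. z is the constant function of type A₁ (resp. A₂).  The βη-normal form of
-- ϱ^Ξ_a M₁ ⋯ Mₙ then has a head variable at the same de Bruijn position as a, and its arguments
-- are the normal forms of the Mᵢ (a in Ξ) or the single argument λ⃗. nf(M) (a in Γ); both
-- encodings are injective.  Normal forms are computed by normalisation by evaluation: βη-equal
-- terms have equal normal forms (via a Kripke PER model) and every term is βη-equal to its
-- normal form (via a Kripke logical relation), so equal normal forms can be compared syntactically.
module Submission where

open import Defs
open import Data.List using (List; []; _∷_; _++_)
open import Data.List.Relation.Unary.All as All using (All; []; _∷_)
open import Data.Nat using (ℕ; zero; suc)
open import Data.Nat.Properties using (suc-injective)
open import Data.Product using (_×_; _,_; proj₁; proj₂)
open import Relation.Binary.PropositionalEquality using (_≡_; refl; sym; trans; cong; cong₂; module ≡-Reasoning) renaming (subst to ≡-subst)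

infix 4 _≗_
_≗_ : ∀ {Γ} {F : Ty → Set} → (∀ {A} → Γ ∋ A → F A) → (∀ {A} → Γ ∋ A → F A) → Set
f ≗ g = ∀ {A} x → f {A} x ≡ g x

extR-cong : ∀ {Γ Δ B} {r r' : Ren Γ Δ} → r ≗ r' → extR {B = B} r ≗ extR r'
extR-cong p Z = refl
extR-cong p (S x) = cong S (p x)

rename-cong : ∀ {Γ Δ} {r r' : Ren Γ Δ} → r ≗ r' → ∀ {A} (t : Tm Γ A) → rename r t ≡ rename r' t
rename-cong p (var x) = cong var (p x)
rename-cong p (lam t) = cong lam (rename-cong (extR-cong p) t)
rename-cong p (app t u) = cong₂ app (rename-cong p t) (rename-cong p u)

rename-∘ : ∀ {Γ Δ Θ} (r : Ren Γ Δ) (r' : Ren Δ Θ) → ∀ {A} (t : Tm Γ A) →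
  rename r' (rename r t) ≡ rename (λ x → r' (r x)) t
rename-∘ r r' (var x) = refl
rename-∘ r r' (lam t) = cong lam (trans (rename-∘ (extR r) (extR r') t)
  (rename-cong (λ { Z → refl ; (S x) → refl }) t))
rename-∘ r r' (app t u) = cong₂ app (rename-∘ r r' t) (rename-∘ r r' u)

rename-id : ∀ {Γ A} (t : Tm Γ A) → rename (λ x → x) t ≡ t
rename-id (var x) = refl
rename-id (lam t) = cong lam (trans (rename-cong (λ { Z → refl ; (S x) → refl }) t) (rename-id t))
rename-id (app t u) = cong₂ app (rename-id t) (rename-id u)

exts-cong : ∀ {Γ Δ B} {σ σ' : Sub Γ Δ} → σ ≗ σ' → exts {B = B} σ ≗ exts σ'
exts-cong p Z = refl
exts-cong p (S x) = cong (rename S) (p x)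

subst-cong : ∀ {Γ Δ} {σ σ' : Sub Γ Δ} → σ ≗ σ' → ∀ {A} (t : Tm Γ A) → subst σ t ≡ subst σ' t
subst-cong p (var x) = p x
subst-cong p (lam t) = cong lam (subst-cong (exts-cong p) t)
subst-cong p (app t u) = cong₂ app (subst-cong p t) (subst-cong p u)

rename-subst : ∀ {Γ Δ Θ} (σ : Sub Γ Δ) (r : Ren Δ Θ) → ∀ {A} (t : Tm Γ A) →
  rename r (subst σ t) ≡ subst (λ x → rename r (σ x)) t
rename-subst σ r (var x) = refl
rename-subst σ r (lam t) = cong lam (trans (rename-subst (exts σ) (extR r) t)
  (subst-cong (λ { Z → refl ; (S x) → trans (rename-∘ S (extR r) (σ x)) (sym (rename-∘ r S (σ x))) }) t))
rename-subst σ r (app t u) = cong₂ app (rename-subst σ r t) (rename-subst σ r u)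

subst-rename : ∀ {Γ Δ Θ} (r : Ren Γ Δ) (σ : Sub Δ Θ) → ∀ {A} (t : Tm Γ A) →
  subst σ (rename r t) ≡ subst (λ x → σ (r x)) t
subst-rename r σ (var x) = refl
subst-rename r σ (lam t) = cong lam (trans (subst-rename (extR r) (exts σ) t)
  (subst-cong (λ { Z → refl ; (S x) → refl }) t))
subst-rename r σ (app t u) = cong₂ app (subst-rename r σ t) (subst-rename r σ u)

subst-subst : ∀ {Γ Δ Θ} (τ : Sub Γ Δ) (σ : Sub Δ Θ) → ∀ {A} (t : Tm Γ A) →
  subst σ (subst τ t) ≡ subst (λ x → subst σ (τ x)) t
subst-subst τ σ (var x) = refl
subst-subst τ σ (lam t) = cong lam (trans (subst-subst (exts τ) (exts σ) t)
  (subst-cong (λ { Z → refl ; (S x) → trans (subst-rename S (exts σ) (τ x)) (sym (rename-subst σ S (τ x))) }) t))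
subst-subst τ σ (app t u) = cong₂ app (subst-subst τ σ t) (subst-subst τ σ u)

subst-id : ∀ {Γ A} (t : Tm Γ A) → subst var t ≡ t
subst-id (var x) = refl
subst-id (lam t) = cong lam (trans (subst-cong (λ { Z → refl ; (S x) → refl }) t) (subst-id t))
subst-id (app t u) = cong₂ app (subst-id t) (subst-id u)

subst-var-rename : ∀ {Γ Δ} (r : Ren Γ Δ) → ∀ {A} (t : Tm Γ A) → subst (λ x → var (r x)) t ≡ rename r t
subst-var-rename r (var x) = refl
subst-var-rename r (lam t) =
  cong lam (trans (subst-cong (λ { Z → refl ; (S x) → refl }) t) (subst-var-rename (extR r) t))
subst-var-rename r (app t u) = cong₂ app (subst-var-rename r t) (subst-var-rename r u)

subst-single-weaken : ∀ {Γ A B} (s : Tm Γ B) (t : Tm Γ A) → subst (single s) (rename S t) ≡ t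
subst-single-weaken s t = trans (subst-rename S (single s) t) (subst-id t)

≡⇒≈ : ∀ {Γ A} {t u : Tm Γ A} → t ≡ u → t ≈ u
≡⇒≈ refl = ≈-refl

rename-≈ : ∀ {Γ Δ} (r : Ren Γ Δ) → ∀ {A} {t u : Tm Γ A} → t ≈ u → rename r t ≈ rename r u
rename-≈ r ≈-refl = ≈-refl
rename-≈ r (≈-sym p) = ≈-sym (rename-≈ r p)
rename-≈ r (≈-trans p q) = ≈-trans (rename-≈ r p) (rename-≈ r q)
rename-≈ r (≈-lam p) = ≈-lam (rename-≈ (extR r) p)
rename-≈ r (≈-app p q) = ≈-app (rename-≈ r p) (rename-≈ r q)
rename-≈ r (≈-β t u) = ≈-trans (≈-β (rename (extR r) t) (rename r u))
  (≡⇒≈ (trans (subst-rename (extR r) (single (rename r u)) t)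
    (trans (subst-cong (λ { Z → refl ; (S x) → refl }) t) (sym (rename-subst (single u) r t)))))
rename-≈ r (≈-η t) = ≈-trans (≈-η (rename r t))
  (≡⇒≈ (cong (λ z → lam (app z (var Z))) (trans (rename-∘ r S t) (sym (rename-∘ S (extR r) t)))))

apps-≈ : ∀ {Γ As} {t t' : Tm Γ (ty As)} (Ms : Args Γ As) → t ≈ t' → apps t Ms ≈ apps t' Ms
apps-≈ [] p = p
apps-≈ (M ∷ Ms) p = apps-≈ Ms (≈-app p ≈-refl)

-- β-normal η-long forms

mutual
  data Ne (Γ : Ctx) : Ty → Set where
    nvar : ∀ {A} → Γ ∋ A → Ne Γ A
    napp : ∀ {A Bs} → Ne Γ (ty (A ∷ Bs)) → Nf Γ A → Ne Γ (ty Bs)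

  data Nf (Γ : Ctx) : Ty → Set where
    nne : Ne Γ o → Nf Γ o
    nlam : ∀ {A Bs} → Nf (A ∷ Γ) (ty Bs) → Nf Γ (ty (A ∷ Bs))

mutual
  renNe : ∀ {Γ Δ} → Ren Γ Δ → ∀ {A} → Ne Γ A → Ne Δ A
  renNe r (nvar x) = nvar (r x)
  renNe r (napp n u) = napp (renNe r n) (renNf r u)

  renNf : ∀ {Γ Δ} → Ren Γ Δ → ∀ {A} → Nf Γ A → Nf Δ A
  renNf r (nne n) = nne (renNe r n)
  renNf r (nlam u) = nlam (renNf (extR r) u)

mutual
  renNe-cong : ∀ {Γ Δ} {r r' : Ren Γ Δ} → r ≗ r' → ∀ {A} (n : Ne Γ A) → renNe r n ≡ renNe r' n
  renNe-cong p (nvar x) = cong nvar (p x)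
  renNe-cong p (napp n u) = cong₂ napp (renNe-cong p n) (renNf-cong p u)

  renNf-cong : ∀ {Γ Δ} {r r' : Ren Γ Δ} → r ≗ r' → ∀ {A} (u : Nf Γ A) → renNf r u ≡ renNf r' u
  renNf-cong p (nne n) = cong nne (renNe-cong p n)
  renNf-cong p (nlam u) = cong nlam (renNf-cong (extR-cong p) u)

mutual
  renNe-id : ∀ {Γ A} (n : Ne Γ A) → renNe (λ x → x) n ≡ n
  renNe-id (nvar x) = refl
  renNe-id (napp n u) = cong₂ napp (renNe-id n) (renNf-id u)

  renNf-id : ∀ {Γ A} (u : Nf Γ A) → renNf (λ x → x) u ≡ u
  renNf-id (nne n) = cong nne (renNe-id n)
  renNf-id (nlam u) = cong nlam (trans (renNf-cong (λ { Z → refl ; (S x) → refl }) u) (renNf-id u))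

mutual
  renNe-∘ : ∀ {Γ Δ Θ} (r : Ren Γ Δ) (r' : Ren Δ Θ) → ∀ {A} (n : Ne Γ A) →
    renNe r' (renNe r n) ≡ renNe (λ x → r' (r x)) n
  renNe-∘ r r' (nvar x) = refl
  renNe-∘ r r' (napp n u) = cong₂ napp (renNe-∘ r r' n) (renNf-∘ r r' u)

  renNf-∘ : ∀ {Γ Δ Θ} (r : Ren Γ Δ) (r' : Ren Δ Θ) → ∀ {A} (u : Nf Γ A) →
    renNf r' (renNf r u) ≡ renNf (λ x → r' (r x)) u
  renNf-∘ r r' (nne n) = cong nne (renNe-∘ r r' n)
  renNf-∘ r r' (nlam u) = cong nlam (trans (renNf-∘ (extR r) (extR r') u)
    (renNf-cong (λ { Z → refl ; (S x) → refl }) u))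

mutual
  embNe : ∀ {Γ A} → Ne Γ A → Tm Γ A
  embNe (nvar x) = var x
  embNe (napp n u) = app (embNe n) (embNf u)

  embNf : ∀ {Γ A} → Nf Γ A → Tm Γ A
  embNf (nne n) = embNe n
  embNf (nlam u) = lam (embNf u)

mutual
  embNe-rename : ∀ {Γ Δ} (r : Ren Γ Δ) → ∀ {A} (n : Ne Γ A) → rename r (embNe n) ≡ embNe (renNe r n)
  embNe-rename r (nvar x) = refl
  embNe-rename r (napp n u) = cong₂ app (embNe-rename r n) (embNf-rename r u)

  embNf-rename : ∀ {Γ Δ} (r : Ren Γ Δ) → ∀ {A} (u : Nf Γ A) → rename r (embNf u) ≡ embNf (renNf r u)
  embNf-rename r (nne n) = embNe-rename r n
  embNf-rename r (nlam u) = cong lam (embNf-rename (extR r) u)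

-- The presheaf model and normalisation

mutual
  Val : Ty → Ctx → Set
  Val (ty As) Γ = ValL As Γ

  ValL : List Ty → Ctx → Set
  ValL [] Γ = Nf Γ o
  ValL (A ∷ As) Γ = ∀ {Δ} → Ren Γ Δ → Val A Δ → ValL As Δ

renameVal : ∀ A {Γ Δ} → Ren Γ Δ → Val A Γ → Val A Δ
renameVal (ty []) r v = renNf r v
renameVal (ty (A ∷ As)) r f = λ r' a → f (λ x → r' (r x)) a

mutual
  reify : ∀ A {Γ} → Val A Γ → Nf Γ A
  reify (ty []) v = v
  reify (ty (A ∷ As)) f = nlam (reify (ty As) (f S (reflect A (nvar Z))))

  reflect : ∀ A {Γ} → Ne Γ A → Val A Γ
  reflect (ty []) n = nne n
  reflect (ty (A ∷ As)) n = λ r a → reflect (ty As) (napp (renNe r n) (reify A a))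

Env : Ctx → Ctx → Set
Env Γ Δ = ∀ {A} → Γ ∋ A → Val A Δ

extendEnv : ∀ {Γ Δ A} → Env Γ Δ → Val A Δ → Env (A ∷ Γ) Δ
extendEnv ρ a Z = a
extendEnv ρ a (S x) = ρ x

renameEnv : ∀ {Γ Δ Θ} → Ren Δ Θ → Env Γ Δ → Env Γ Θ
renameEnv r ρ {A} x = renameVal A r (ρ x)

eval : ∀ {Γ Δ A} → Tm Γ A → Env Γ Δ → Val A Δ
eval (var x) ρ = ρ x
eval (lam t) ρ = λ r a → eval t (extendEnv (renameEnv r ρ) a)
eval (app t u) ρ = eval t ρ (λ x → x) (eval u ρ)

idEnv : ∀ {Γ} → Env Γ Γ
idEnv {A = A} x = reflect A (nvar x)

nf : ∀ {Γ A} → Tm Γ A → Nf Γ A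
nf {A = A} t = reify A (eval t idEnv)

-- Soundness: a Kripke PER on values

mutual
  EqVal : ∀ A {Γ} → Val A Γ → Val A Γ → Set
  EqVal (ty As) v w = EqValL As v w

  EqValL : ∀ As {Γ} → ValL As Γ → ValL As Γ → Set
  EqValL [] v w = v ≡ w
  EqValL (A ∷ As) f g = Extensional A As f g × Uniform A As f × Uniform A As g

  Extensional : ∀ A As {Γ} → ValL (A ∷ As) Γ → ValL (A ∷ As) Γ → Set
  Extensional A As {Γ} f g = ∀ {Δ} (r : Ren Γ Δ) {a b} → EqVal A a b → EqValL As (f r a) (g r b)

  Uniform : ∀ A As {Γ} → ValL (A ∷ As) Γ → Set
  Uniform A As {Γ} f = ∀ {Δ Θ} (r : Ren Γ Δ) (r' : Ren Δ Θ) {a} → EqVal A a a →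
    EqValL As (renameVal (ty As) r' (f r a)) (f (λ x → r' (r x)) (renameVal A r' a))

mutual
  EqVal-sym : ∀ A {Γ} {a b : Val A Γ} → EqVal A a b → EqVal A b a
  EqVal-sym (ty As) p = EqValL-sym As p

  EqValL-sym : ∀ As {Γ} {a b : ValL As Γ} → EqValL As a b → EqValL As b a
  EqValL-sym [] p = sym p
  EqValL-sym (A ∷ As) (e , u₁ , u₂) = (λ r ab → EqValL-sym As (e r (EqVal-sym A ab))) , u₂ , u₁

mutual
  EqVal-trans : ∀ A {Γ} {a b c : Val A Γ} → EqVal A a b → EqVal A b c → EqVal A a c
  EqVal-trans (ty As) p q = EqValL-trans As p q

  EqValL-trans : ∀ As {Γ} {a b c : ValL As Γ} → EqValL As a b → EqValL As b c → EqValL As a c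
  EqValL-trans [] p q = trans p q
  EqValL-trans (A ∷ As) (e , u₁ , _) (e' , _ , u₂') =
    (λ r ab → EqValL-trans As (e r ab) (e' r (EqVal-trans A (EqVal-sym A ab) ab))) , u₁ , u₂'

EqVal-reflˡ : ∀ A {Γ} {a b : Val A Γ} → EqVal A a b → EqVal A a a
EqVal-reflˡ A p = EqVal-trans A p (EqVal-sym A p)

EqVal-reflʳ : ∀ A {Γ} {a b : Val A Γ} → EqVal A a b → EqVal A b b
EqVal-reflʳ A p = EqVal-trans A (EqVal-sym A p) p

renameVal-Eq : ∀ A {Γ Δ} (r : Ren Γ Δ) {a b : Val A Γ} → EqVal A a b →
  EqVal A (renameVal A r a) (renameVal A r b)
renameVal-Eq (ty []) r p = cong (renNf r) p
renameVal-Eq (ty (A ∷ As)) r (e , u₁ , u₂) =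
  (λ r' ab → e (λ x → r' (r x)) ab) ,
  (λ r₁ r₂ aa → u₁ (λ x → r₁ (r x)) r₂ aa) ,
  (λ r₁ r₂ aa → u₂ (λ x → r₁ (r x)) r₂ aa)

renameVal-id : ∀ A {Γ} {a : Val A Γ} → EqVal A a a → EqVal A (renameVal A (λ x → x) a) a
renameVal-id (ty []) {a = a} p = renNf-id a
renameVal-id (ty (A ∷ As)) p = p

renameVal-∘ : ∀ A {Γ Δ Θ} (r : Ren Γ Δ) (r' : Ren Δ Θ) {a : Val A Γ} → EqVal A a a →
  EqVal A (renameVal A r' (renameVal A r a)) (renameVal A (λ x → r' (r x)) a)
renameVal-∘ (ty []) r r' {a = a} p = renNf-∘ r r' a
renameVal-∘ (ty (A ∷ As)) r r' (e , u , _) =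
  (λ r₂ ab → e (λ x → r₂ (r' (r x))) ab) ,
  (λ r₁ r₂ aa → u (λ x → r₁ (r' (r x))) r₂ aa) ,
  (λ r₁ r₂ aa → u (λ x → r₁ (r' (r x))) r₂ aa)

mutual
  reify-Eq : ∀ A {Γ} {a b : Val A Γ} → EqVal A a b → reify A a ≡ reify A b
  reify-Eq (ty As) p = reify-EqL As p

  reify-EqL : ∀ As {Γ} {a b : Val (ty As) Γ} → EqValL As a b → reify (ty As) a ≡ reify (ty As) b
  reify-EqL [] p = p
  reify-EqL (A ∷ As) (e , _ , _) = cong nlam (reify-EqL As (e S (reflect-Eq A (nvar Z))))

  reflect-≡ : ∀ As {Γ} {n m : Ne Γ (ty As)} → n ≡ m → EqValL As (reflect (ty As) n) (reflect (ty As) m)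
  reflect-≡ As {n = n} refl = reflect-EqL As n

  reflect-Eq : ∀ A {Γ} (n : Ne Γ A) → EqVal A (reflect A n) (reflect A n)
  reflect-Eq (ty As) n = reflect-EqL As n

  reflect-EqL : ∀ As {Γ} (n : Ne Γ (ty As)) → EqValL As (reflect (ty As) n) (reflect (ty As) n)
  reflect-EqL [] n = refl
  reflect-EqL (A ∷ As) n = reflect-extensional A As n , reflect-uniform A As n , reflect-uniform A As n

  reflect-extensional : ∀ A As {Γ} (n : Ne Γ (ty (A ∷ As))) →
    Extensional A As (reflect (ty (A ∷ As)) n) (reflect (ty (A ∷ As)) n)
  reflect-extensional A As n r ab = reflect-≡ As (cong (napp (renNe r n)) (reify-Eq A ab))

  reflect-uniform : ∀ A As {Γ} (n : Ne Γ (ty (A ∷ As))) → Uniform A As (reflect (ty (A ∷ As)) n)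
  reflect-uniform A As n r r' {a} aa =
    EqValL-trans As (renameVal-reflectL As r' (napp (renNe r n) (reify A a)))
      (reflect-≡ As (cong₂ napp (renNe-∘ r r' n) (reify-rename A r' aa)))

  renameVal-reflect : ∀ A {Γ Δ} (r : Ren Γ Δ) (n : Ne Γ A) →
    EqVal A (renameVal A r (reflect A n)) (reflect A (renNe r n))
  renameVal-reflect (ty As) r n = renameVal-reflectL As r n

  renameVal-reflectL : ∀ As {Γ Δ} (r : Ren Γ Δ) (n : Ne Γ (ty As)) →
    EqValL As (renameVal (ty As) r (reflect (ty As) n)) (reflect (ty As) (renNe r n))
  renameVal-reflectL [] r n = refl
  renameVal-reflectL (A ∷ As) r n =
    (λ r' ab → reflect-≡ As (cong₂ napp (sym (renNe-∘ r r' n)) (reify-Eq A ab))) ,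
    (λ r₁ r₂ aa → reflect-uniform A As n (λ x → r₁ (r x)) r₂ aa) ,
    reflect-uniform A As (renNe r n)

  reify-rename : ∀ A {Γ Δ} (r : Ren Γ Δ) {a : Val A Γ} → EqVal A a a →
    renNf r (reify A a) ≡ reify A (renameVal A r a)
  reify-rename (ty As) r aa = reify-renameL As r aa

  reify-renameL : ∀ As {Γ Δ} (r : Ren Γ Δ) {a : Val (ty As) Γ} → EqValL As a a →
    renNf r (reify (ty As) a) ≡ reify (ty As) (renameVal (ty As) r a)
  reify-renameL [] r aa = refl
  reify-renameL (A ∷ As) r (e , u , _) =
    cong nlam (trans (reify-renameL As (extR r) (e S (reflect-Eq A (nvar Z))))
      (reify-EqL As (EqValL-trans As (u S (extR r) (reflect-Eq A (nvar Z)))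
        (e (λ x → S (r x)) (renameVal-reflect A (extR r) (nvar Z))))))

EqEnv : ∀ {Γ Δ} → Env Γ Δ → Env Γ Δ → Set
EqEnv {Γ} ρ ρ' = ∀ {A} (x : Γ ∋ A) → EqVal A (ρ x) (ρ' x)

extendEnv-Eq : ∀ {Γ Δ A} {ρ ρ' : Env Γ Δ} {a b : Val A Δ} → EqEnv ρ ρ' → EqVal A a b →
  EqEnv (extendEnv {A = A} ρ a) (extendEnv ρ' b)
extendEnv-Eq p ab Z = ab
extendEnv-Eq p ab (S x) = p x

renameEnv-Eq : ∀ {Γ Δ Θ} (r : Ren Δ Θ) {ρ ρ' : Env Γ Δ} → EqEnv ρ ρ' → EqEnv (renameEnv r ρ) (renameEnv r ρ')
renameEnv-Eq r p {A} x = renameVal-Eq A r (p x)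

EqEnv-sym : ∀ {Γ Δ} {ρ ρ' : Env Γ Δ} → EqEnv ρ ρ' → EqEnv ρ' ρ
EqEnv-sym p {A} x = EqVal-sym A (p x)

EqEnv-reflˡ : ∀ {Γ Δ} {ρ ρ' : Env Γ Δ} → EqEnv ρ ρ' → EqEnv ρ ρ
EqEnv-reflˡ p {A} x = EqVal-reflˡ A (p x)

EqEnv-reflʳ : ∀ {Γ Δ} {ρ ρ' : Env Γ Δ} → EqEnv ρ ρ' → EqEnv ρ' ρ'
EqEnv-reflʳ p {A} x = EqVal-reflʳ A (p x)

idEnv-Eq : ∀ {Γ} → EqEnv (idEnv {Γ}) idEnv
idEnv-Eq {A = A} x = reflect-Eq A (nvar x)

mutual
  eval-Eq : ∀ {Γ Δ A} (t : Tm Γ A) {ρ ρ' : Env Γ Δ} → EqEnv ρ ρ' → EqVal A (eval t ρ) (eval t ρ')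
  eval-Eq (var x) p = p x
  eval-Eq (app t u) p = proj₁ (eval-Eq t p) (λ x → x) (eval-Eq u p)
  eval-Eq (lam t) p = (λ r ab → eval-Eq t (extendEnv-Eq (renameEnv-Eq r p) ab)) ,
    eval-lam-uniform t (EqEnv-reflˡ p) , eval-lam-uniform t (EqEnv-reflʳ p)

  eval-lam-uniform : ∀ {Γ Δ A Bs} (t : Tm (A ∷ Γ) (ty Bs)) {ρ : Env Γ Δ} → EqEnv ρ ρ →
    Uniform A Bs (eval (lam t) ρ)
  eval-lam-uniform {A = A} {Bs} t pρ r r' aa =
    EqValL-trans Bs (renameVal-eval t r' (extendEnv-Eq (renameEnv-Eq r pρ) aa))
      (eval-Eq t (λ { Z → renameVal-Eq A r' aa ; (S {A = C} x) → renameVal-∘ C r r' (pρ x) }))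

  renameVal-eval : ∀ {Γ Δ Θ A} (t : Tm Γ A) (r : Ren Δ Θ) {ρ ρ' : Env Γ Δ} → EqEnv ρ ρ' →
    EqVal A (renameVal A r (eval t ρ)) (eval t (renameEnv r ρ'))
  renameVal-eval {A = A} (var x) r p = renameVal-Eq A r (p x)
  renameVal-eval {A = ty Bs} (app t u) r p =
    EqValL-trans Bs (proj₁ (proj₂ (eval-Eq t (EqEnv-reflˡ p))) (λ x → x) r (eval-Eq u (EqEnv-reflˡ p)))
      (proj₁ (renameVal-eval t r p) (λ x → x) (renameVal-eval u r p))
  renameVal-eval {A = ty (A ∷ Bs)} (lam t) r p =
    (λ r' ab → eval-Eq t (λ { Z → ab ; (S {A = C} x) →
        EqVal-trans C (renameVal-Eq C (λ y → r' (r y)) (p x))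
          (EqVal-sym C (renameVal-∘ C r r' (EqVal-reflʳ C (p x)))) })) ,
    proj₁ (proj₂ (renameVal-Eq (ty (A ∷ Bs)) r (eval-Eq (lam t) (EqEnv-reflˡ p)))) ,
    eval-lam-uniform t (renameEnv-Eq r (EqEnv-reflʳ p))

eval-rename : ∀ {Γ Γ' Δ A} (t : Tm Γ A) (w : Ren Γ Γ') {ρ : Env Γ' Δ} {ρ' : Env Γ Δ} →
  EqEnv ρ ρ → (∀ {B} (x : Γ ∋ B) → EqVal B (ρ (w x)) (ρ' x)) →
  EqVal A (eval (rename w t) ρ) (eval t ρ')
eval-rename (var x) w pρ p = p x
eval-rename (app t u) w pρ p = proj₁ (eval-rename t w pρ p) (λ x → x) (eval-rename u w pρ p)
eval-rename {A = ty (A ∷ Bs)} (lam t) w {ρ} {ρ'} pρ p =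
  (λ r {a} {b} ab → eval-rename t (extR w) {ρ' = extendEnv (renameEnv r ρ') b}
     (extendEnv-Eq (renameEnv-Eq r pρ) (EqVal-reflˡ A ab))
     (λ { Z → ab ; (S {A = C} x) → renameVal-Eq C r (p x) })) ,
  eval-lam-uniform (rename (extR w) t) pρ ,
  eval-lam-uniform t (λ {B} x → EqVal-reflʳ B (p x))

eval-subst : ∀ {Γ Γ' Δ A} (t : Tm Γ A) (σ : Sub Γ Γ') {ρ : Env Γ' Δ} {ρ' : Env Γ Δ} →
  EqEnv ρ ρ → (∀ {B} (x : Γ ∋ B) → EqVal B (eval (σ x) ρ) (ρ' x)) →
  EqVal A (eval (subst σ t) ρ) (eval t ρ')
eval-subst (var x) σ pρ p = p x
eval-subst (app t u) σ pρ p = proj₁ (eval-subst t σ pρ p) (λ x → x) (eval-subst u σ pρ p)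
eval-subst {A = ty (A ∷ Bs)} (lam t) σ {ρ} {ρ'} pρ p =
  (λ r {a} {b} ab → eval-subst t (exts σ) {ρ' = extendEnv (renameEnv r ρ') b}
     (extendEnv-Eq (renameEnv-Eq r pρ) (EqVal-reflˡ A ab))
     (λ { Z → ab ; (S {A = C} x) →
        EqVal-trans C (eval-rename (σ x) S {ρ' = renameEnv r ρ} (extendEnv-Eq (renameEnv-Eq r pρ) (EqVal-reflˡ A ab))
                                   (λ {B} y → EqVal-reflˡ B (renameEnv-Eq r pρ y)))
          (EqVal-trans C (EqVal-sym C (renameVal-eval (σ x) r pρ)) (renameVal-Eq C r (p x))) })) ,
  eval-lam-uniform (subst (exts σ) t) pρ ,
  eval-lam-uniform t (λ {B} x → EqVal-reflʳ B (p x))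

eval-≈ : ∀ {Γ Δ A} {t u : Tm Γ A} → t ≈ u → {ρ ρ' : Env Γ Δ} → EqEnv ρ ρ' → EqVal A (eval t ρ) (eval u ρ')
eval-≈ {t = t} ≈-refl pe = eval-Eq t pe
eval-≈ {A = A} (≈-sym p) pe = EqVal-sym A (eval-≈ p (EqEnv-sym pe))
eval-≈ {A = A} (≈-trans p q) pe = EqVal-trans A (eval-≈ p pe) (eval-≈ q (EqEnv-reflʳ pe))
eval-≈ (≈-lam {t = t} {u = u} p) pe = (λ r ab → eval-≈ p (extendEnv-Eq (renameEnv-Eq r pe) ab)) ,
  eval-lam-uniform t (EqEnv-reflˡ pe) , eval-lam-uniform u (EqEnv-reflʳ pe)
eval-≈ (≈-app p q) pe = proj₁ (eval-≈ p pe) (λ x → x) (eval-≈ q pe)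
eval-≈ {A = A} (≈-β t u) {ρ} pe =
  EqVal-sym A (eval-subst t (single u) {ρ' = extendEnv (renameEnv (λ x → x) ρ) (eval u ρ)} (EqEnv-reflʳ pe)
    (λ { Z → eval-Eq u (EqEnv-sym pe)
       ; (S {A = C} x) → EqVal-sym C (EqVal-trans C (renameVal-id C (EqEnv-reflˡ pe x)) (pe x)) }))
eval-≈ {A = ty (A ∷ Bs)} (≈-η t) pe =
  (λ r ab → EqValL-trans Bs (proj₁ (renameVal-eval t r pe) (λ x → x) ab)
     (EqVal-sym (ty Bs) (proj₁ (eval-rename t S (extendEnv-Eq (renameEnv-Eq r (EqEnv-reflʳ pe)) (EqVal-reflʳ A ab))
        (λ {B} x → renameVal-Eq B r (EqEnv-reflʳ pe x))) (λ x → x) (EqVal-reflʳ A ab)))) ,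
  proj₁ (proj₂ (eval-Eq t (EqEnv-reflˡ pe))) ,
  eval-lam-uniform (app (rename S t) (var Z)) (EqEnv-reflʳ pe)

nf-≈ : ∀ {Γ A} {t u : Tm Γ A} → t ≈ u → nf t ≡ nf u
nf-≈ {A = A} p = reify-Eq A (eval-≈ p idEnv-Eq)

-- Completeness: a Kripke logical relation between terms and values

mutual
  Reads : ∀ A {Γ} → Tm Γ A → Val A Γ → Set
  Reads (ty As) t v = ReadsL As t v

  ReadsL : ∀ As {Γ} → Tm Γ (ty As) → ValL As Γ → Set
  ReadsL [] t v = t ≈ embNf v
  ReadsL (A ∷ As) {Γ} t f = ∀ {Δ} (w : Ren Γ Δ) {s a} → Reads A s a → ReadsL As (app (rename w t) s) (f w a)

ReadsL-≈ : ∀ As {Γ} {t t' : Tm Γ (ty As)} {v : ValL As Γ} → t ≈ t' → ReadsL As t v → ReadsL As t' v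
ReadsL-≈ [] p q = ≈-trans (≈-sym p) q
ReadsL-≈ (A ∷ As) p q = λ w sa → ReadsL-≈ As (≈-app (rename-≈ w p) ≈-refl) (q w sa)

Reads-rename : ∀ A {Γ Δ} (w : Ren Γ Δ) {t : Tm Γ A} {v : Val A Γ} → Reads A t v →
  Reads A (rename w t) (renameVal A w v)
Reads-rename (ty []) w {t} {v} q = ≈-trans (rename-≈ w q) (≡⇒≈ (embNf-rename w v))
Reads-rename (ty (A ∷ As)) w {t} q = λ w' {s} sa →
  ReadsL-≈ As (≡⇒≈ (cong (λ z → app z s) (sym (rename-∘ w w' t)))) (q (λ x → w' (w x)) sa)

mutual
  reify-Reads : ∀ A {Γ} {t : Tm Γ A} {v : Val A Γ} → Reads A t v → t ≈ embNf (reify A v)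
  reify-Reads (ty As) q = reify-ReadsL As q

  reify-ReadsL : ∀ As {Γ} {t : Tm Γ (ty As)} {v : ValL As Γ} → ReadsL As t v → t ≈ embNf (reify (ty As) v)
  reify-ReadsL [] q = q
  reify-ReadsL (A ∷ As) {t = t} q = ≈-trans (≈-η t) (≈-lam (reify-ReadsL As (q S (reflect-Reads A (nvar Z)))))

  reflect-Reads : ∀ A {Γ} (n : Ne Γ A) → Reads A (embNe n) (reflect A n)
  reflect-Reads (ty As) n = reflect-ReadsL As n

  reflect-ReadsL : ∀ As {Γ} (n : Ne Γ (ty As)) → ReadsL As (embNe n) (reflect (ty As) n)
  reflect-ReadsL [] n = ≈-refl
  reflect-ReadsL (A ∷ As) n = λ w {s} {a} sa →
    ReadsL-≈ As (≈-app (≡⇒≈ (sym (embNe-rename w n))) (≈-sym (reify-Reads A sa)))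
      (reflect-ReadsL As (napp (renNe w n) (reify A a)))

eval-Reads : ∀ {Γ Δ A} (t : Tm Γ A) (σ : Sub Γ Δ) (ρ : Env Γ Δ) →
  (∀ {B} (x : Γ ∋ B) → Reads B (σ x) (ρ x)) → Reads A (subst σ t) (eval t ρ)
eval-Reads (var x) σ ρ p = p x
eval-Reads {A = ty Bs} (app t u) σ ρ p =
  ReadsL-≈ Bs (≡⇒≈ (cong (λ z → app z (subst σ u)) (rename-id (subst σ t))))
    (eval-Reads t σ ρ p (λ x → x) (eval-Reads u σ ρ p))
eval-Reads {A = ty (A ∷ Bs)} (lam t) σ ρ p = λ w {s} {a} sa →
  ReadsL-≈ Bs (≈-sym (≈-trans (≈-β (rename (extR w) (subst (exts σ) t)) s) (≡⇒≈ (β-reduct w s))))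
    (eval-Reads t (σ′ w s) (extendEnv (renameEnv w ρ) a) (λ { Z → sa ; (S {A = C} x) → Reads-rename C w (p x) }))
  where
  σ′ : ∀ {Δ'} → Ren _ Δ' → Tm Δ' A → Sub (A ∷ _) Δ'
  σ′ w s Z = s
  σ′ w s (S x) = rename w (σ x)

  β-reduct : ∀ {Δ'} (w : Ren _ Δ') (s : Tm Δ' A) →
    subst (single s) (rename (extR w) (subst (exts σ) t)) ≡ subst (σ′ w s) t
  β-reduct w s = trans (subst-rename (extR w) (single s) (subst (exts σ) t))
    (trans (subst-subst (exts σ) _ t)
      (subst-cong (λ { Z → refl ; (S x) → trans (subst-rename S _ (σ x)) (subst-var-rename w (σ x)) }) t))

nf-complete : ∀ {Γ A} (t : Tm Γ A) → t ≈ embNf (nf t)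
nf-complete {A = A} t =
  reify-Reads A (≡-subst (λ z → Reads A z (eval t idEnv)) (subst-id t)
    (eval-Reads t var idEnv (λ {B} x → reflect-Reads B (nvar x))))

embNf-nf-≈⇒≈ : ∀ {Γ A} {t u : Tm Γ A} → embNf (nf t) ≈ embNf (nf u) → t ≈ u
embNf-nf-≈⇒≈ {t = t} {u} p = ≈-trans (nf-complete t) (≈-trans p (≈-sym (nf-complete u)))

nf-≡⇒≈ : ∀ {Γ A} {t u : Tm Γ A} → nf t ≡ nf u → t ≈ u
nf-≡⇒≈ p = embNf-nf-≈⇒≈ (≡⇒≈ (cong embNf p))

nfs : ∀ {Γ As} → Args Γ As → All (Nf Γ) As
nfs [] = []
nfs (M ∷ Ms) = nf M ∷ nfs Ms

nfs-≡⇒ArgsEq : ∀ {Γ As} (Ms Ns : Args Γ As) → nfs Ms ≡ nfs Ns → ArgsEq Ms Ns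
nfs-≡⇒ArgsEq [] [] p = []
nfs-≡⇒ArgsEq (M ∷ Ms) (N ∷ Ns) p = nf-≡⇒≈ (cong All.head p) ∷ nfs-≡⇒ArgsEq Ms Ns (cong All.tail p)

napps : ∀ {Γ As} → Ne Γ (ty As) → All (Nf Γ) As → Ne Γ o
napps n [] = n
napps n (u ∷ us) = napps (napp n u) us

nne-injective : ∀ {Γ} {n m : Ne Γ o} → nne n ≡ nne m → n ≡ m
nne-injective refl = refl

napp-injective : ∀ {Γ A Bs} {n m : Ne Γ (ty (A ∷ Bs))} {u v : Nf Γ A} → napp n u ≡ napp m v → n ≡ m × u ≡ v
napp-injective refl = refl , refl

napps-injective : ∀ {Γ As} {n m : Ne Γ (ty As)} (us vs : All (Nf Γ) As) →
  napps n us ≡ napps m vs → n ≡ m × us ≡ vs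
napps-injective [] [] p = p , refl
napps-injective (u ∷ us) (v ∷ vs) p with napps-injective us vs p
... | q , refl with napp-injective q
... | refl , refl = refl , refl

nf-apps-neutral : ∀ As {Γ} (t : Tm Γ (ty As)) (n : Ne Γ (ty As)) →
  EqValL As (eval t idEnv) (reflect (ty As) n) →
  (Ms : Args Γ As) → nf (apps t Ms) ≡ nne (napps n (nfs Ms))
nf-apps-neutral [] t n e [] = e
nf-apps-neutral (A ∷ As) t n e (M ∷ Ms) = nf-apps-neutral As (app t M) (napp n (nf M))
  (EqValL-trans As (proj₁ e (λ x → x) (eval-Eq M idEnv-Eq))
    (reflect-≡ As (cong (λ z → napp z (nf M)) (renNe-id n)))) Ms

nf-apps-var : ∀ {Γ As} (x : Γ ∋ ty As) (Ms : Args Γ As) → nf (apps (var x) Ms) ≡ nne (napps (nvar x) (nfs Ms))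
nf-apps-var {As = As} x = nf-apps-neutral As (var x) (nvar x) (reflect-EqL As (nvar x))

constTm : ∀ Bs {Γ} → Tm Γ o → Tm Γ (ty Bs)
constTm [] t = t
constTm (B ∷ Bs) t = lam (constTm Bs (rename S t))

constNf : ∀ Bs {Γ} → Nf Γ o → Nf Γ (ty Bs)
constNf [] v = v
constNf (B ∷ Bs) v = nlam (constNf Bs (renNf S v))

rename-constTm : ∀ Bs {Γ Δ} (r : Ren Γ Δ) (t : Tm Γ o) → rename r (constTm Bs t) ≡ constTm Bs (rename r t)
rename-constTm [] r t = refl
rename-constTm (B ∷ Bs) r t = cong lam (trans (rename-constTm Bs (extR r) (rename S t))
  (cong (constTm Bs) (trans (rename-∘ S (extR r) t) (sym (rename-∘ r S t)))))

subst-constTm : ∀ Bs {Γ Δ} (σ : Sub Γ Δ) (t : Tm Γ o) → subst σ (constTm Bs t) ≡ constTm Bs (subst σ t)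
subst-constTm [] σ t = refl
subst-constTm (B ∷ Bs) σ t = cong lam (trans (subst-constTm Bs (exts σ) (rename S t))
  (cong (constTm Bs) (trans (subst-rename S (exts σ) t) (sym (rename-subst σ S t)))))

apps-constTm : ∀ Bs {Γ} (t : Tm Γ o) (Ms : Args Γ Bs) → apps (constTm Bs t) Ms ≈ t
apps-constTm [] t [] = ≈-refl
apps-constTm (B ∷ Bs) t (M ∷ Ms) =
  ≈-trans (apps-≈ Ms (≈-trans (≈-β (constTm Bs (rename S t)) M)
      (≡⇒≈ (trans (subst-constTm Bs (single M) (rename S t)) (cong (constTm Bs) (subst-single-weaken M t))))))
    (apps-constTm Bs t Ms)

embNf-constNf : ∀ Bs {Γ} (v : Nf Γ o) → embNf (constNf Bs v) ≡ constTm Bs (embNf v)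
embNf-constNf [] v = refl
embNf-constNf (B ∷ Bs) v =
  cong lam (trans (embNf-constNf Bs (renNf S v)) (cong (constTm Bs) (sym (embNf-rename S v))))

constArgs : ∀ {Γ} → Tm Γ o → ∀ Bs → Args Γ Bs
constArgs t [] = []
constArgs t (ty Cs ∷ Bs) = constTm Cs t ∷ constArgs t Bs

-- Apply both constant functions to some arguments (any will do; constant ones are at hand) and β-reduce.
constNf-injective : ∀ Bs {Γ} (u v : Nf Γ o) → constNf Bs u ≡ constNf Bs v → embNf u ≈ embNf v
constNf-injective Bs u v p =
  ≈-trans (≈-sym (apps-constTm Bs (embNf u) Ms))
    (≈-trans (≡⇒≈ (cong (λ z → apps z Ms) (trans (sym (embNf-constNf Bs u)) (trans (cong embNf p) (embNf-constNf Bs v)))))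
      (apps-constTm Bs (embNf v) Ms))
  where Ms = constArgs (embNf u) Bs

reify-eval-constTm : ∀ Bs {Γ Δ} (x : Γ ∋ o) (ρ : Env Γ Δ) →
  reify (ty Bs) (eval (constTm Bs (var x)) ρ) ≡ constNf Bs (ρ x)
reify-eval-constTm [] x ρ = refl
reify-eval-constTm (B ∷ Bs) x ρ =
  cong nlam (reify-eval-constTm Bs (S x) (extendEnv (renameEnv S ρ) (reflect B (nvar Z))))

viaConst : ∀ {Γ Bs} → Γ ∋ ty (ty Bs ∷ []) → Tm Γ one
viaConst {Bs = Bs} h = lam (app (var (S h)) (constTm Bs (var Z)))

rename-viaConst : ∀ {Γ Δ Bs} (r : Ren Γ Δ) (h : Γ ∋ ty (ty Bs ∷ [])) → rename r (viaConst h) ≡ viaConst (r h)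
rename-viaConst {Bs = Bs} r h = cong (λ z → lam (app (var (S (r h))) z)) (rename-constTm Bs (extR r) (var Z))

nf-viaConst : ∀ {Γ Bs} (h : Γ ∋ ty (ty Bs ∷ [])) (M : Tm Γ o) →
  nf (app (viaConst h) M) ≡ nne (napp (nvar h) (constNf Bs (nf M)))
nf-viaConst {Bs = Bs} h M = cong (λ z → nne (napp (nvar h) z))
  (reify-eval-constTm Bs Z (extendEnv (renameEnv (λ x → x) idEnv) (eval M idEnv)))

index : ∀ {Γ A} → Γ ∋ A → ℕ
index Z = zero
index (S x) = suc (index x)

index-injective : ∀ {Γ A B} (x : Γ ∋ A) (y : Γ ∋ B) → index x ≡ index y → VarEq x y
index-injective Z Z _ = same
index-injective Z (S y) ()
index-injective (S x) Z ()
index-injective (S x) (S y) p with index-injective x y (suc-injective p)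
... | same = same

headIndex : ∀ {Γ A} → Ne Γ A → ℕ
headIndex (nvar x) = index x
headIndex (napp n u) = headIndex n

headIndexNf : ∀ {Γ} → Nf Γ o → ℕ
headIndexNf (nne n) = headIndex n

headIndex-napps : ∀ {Γ As} (n : Ne Γ (ty As)) (us : All (Nf Γ) As) → headIndex (napps n us) ≡ headIndex n
headIndex-napps n [] = refl
headIndex-napps n (u ∷ us) = headIndex-napps (napp n u) us

injL : ∀ Ξ {Γ A} → Ξ ∋ A → (Ξ ++ Γ) ∋ A
injL (X ∷ Ξ) Z = Z
injL (X ∷ Ξ) (S x) = S (injL Ξ x)

injR : ∀ Ξ {Γ A} → Γ ∋ A → (Ξ ++ Γ) ∋ A
injR [] c = c
injR (X ∷ Ξ) c = S (injR Ξ c)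

data Split (Ξ : Ctx) {Γ A} : (Ξ ++ Γ) ∋ A → Set where
  inL : (x : Ξ ∋ A) → Split Ξ (injL Ξ x)
  inR : (c : Γ ∋ A) → Split Ξ (injR Ξ c)

split : ∀ Ξ {Γ A} (x : (Ξ ++ Γ) ∋ A) → Split Ξ x
split [] x = inR x
split (X ∷ Ξ) Z = inL Z
split (X ∷ Ξ) (S x) with split Ξ x
... | inL y = inL (S y)
... | inR c = inR c

index-injL : ∀ Ξ {Γ Γ' A} (x : Ξ ∋ A) → index (injL Ξ {Γ} x) ≡ index (injL Ξ {Γ'} x)
index-injL (X ∷ Ξ) Z = refl
index-injL (X ∷ Ξ) (S x) = cong suc (index-injL Ξ x)

index-injR : ∀ Ξ {Γ Γ' A A'} {c : Γ ∋ A} {c' : Γ' ∋ A'} → index c ≡ index c' → index (injR Ξ c) ≡ index (injR Ξ c')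
index-injR [] p = p
index-injR (X ∷ Ξ) p = cong suc (index-injR Ξ p)

extend-injL : ∀ Ξ {Γ Δ} (ϱ : Sub Γ Δ) {A} (x : Ξ ∋ A) → extend Ξ ϱ (injL Ξ x) ≡ var (injL Ξ x)
extend-injL (X ∷ Ξ) ϱ Z = refl
extend-injL (X ∷ Ξ) ϱ (S x) = cong (rename S) (extend-injL Ξ ϱ x)

extend-injR : ∀ Ξ {Γ Δ} (ϱ : Sub Γ Δ) {A} (c : Γ ∋ A) → extend Ξ ϱ (injR Ξ c) ≡ rename (injR Ξ) (ϱ c)
extend-injR [] ϱ c = sym (rename-id (ϱ c))
extend-injR (X ∷ Ξ) ϱ c = trans (cong (rename S) (extend-injR Ξ ϱ c)) (rename-∘ (injR Ξ) S (ϱ c))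

-- The atomic reduction

module _ (Bs₁ Bs₂ : List Ty) where

  Γ₁₁ : Ctx
  Γ₁₁ = one ∷ one ∷ []

  Δ₁₂ : Ctx
  Δ₁₂ = ty (ty Bs₁ ∷ []) ∷ ty (ty Bs₂ ∷ []) ∷ []

  ϱ : Sub Γ₁₁ Δ₁₂
  ϱ Z = viaConst Z
  ϱ (S Z) = viaConst (S Z)

  module _ (Ξ : Ctx) where

    nf-ϱ-injL : ∀ {As} (x : Ξ ∋ ty As) (Ms : Args (Ξ ++ Δ₁₂) As) →
      nf (apps (extend Ξ ϱ (injL Ξ x)) Ms) ≡ nne (napps (nvar (injL Ξ x)) (nfs Ms))
    nf-ϱ-injL x Ms = trans (cong (λ z → nf (apps z Ms)) (extend-injL Ξ ϱ x)) (nf-apps-var (injL Ξ x) Ms)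

    nf-ϱ-injR : ∀ {Bs} (c : Γ₁₁ ∋ one) (h : Δ₁₂ ∋ ty (ty Bs ∷ [])) → ϱ c ≡ viaConst h →
      (M : Tm (Ξ ++ Δ₁₂) o) → nf (app (extend Ξ ϱ (injR Ξ c)) M) ≡ nne (napp (nvar (injR Ξ h)) (constNf Bs (nf M)))
    nf-ϱ-injR c h ϱc≡ M = begin
      nf (app (extend Ξ ϱ (injR Ξ c)) M)         ≡⟨ cong (λ z → nf (app z M)) (extend-injR Ξ ϱ c) ⟩
      nf (app (rename (injR Ξ) (ϱ c)) M)         ≡⟨ cong (λ z → nf (app (rename (injR Ξ) z) M)) ϱc≡ ⟩
      nf (app (rename (injR Ξ) (viaConst h)) M)  ≡⟨ cong (λ z → nf (app z M)) (rename-viaConst (injR Ξ) h) ⟩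
      nf (app (viaConst (injR Ξ h)) M)           ≡⟨ nf-viaConst (injR Ξ h) M ⟩
      nne (napp (nvar (injR Ξ h)) _)             ∎
      where open ≡-Reasoning

    headIndex-ϱ : ∀ {As} {a : (Ξ ++ Γ₁₁) ∋ ty As} → Split Ξ a → (Ms : Args (Ξ ++ Δ₁₂) As) →
      headIndexNf (nf (apps (extend Ξ ϱ a) Ms)) ≡ index a
    headIndex-ϱ (inL x) Ms = trans (cong headIndexNf (nf-ϱ-injL x Ms))
      (trans (headIndex-napps (nvar (injL Ξ x)) (nfs Ms)) (index-injL Ξ x))
    headIndex-ϱ (inR Z) (M ∷ []) =
      trans (cong headIndexNf (nf-ϱ-injR Z Z refl M)) (index-injR Ξ refl)
    headIndex-ϱ (inR (S Z)) (M ∷ []) =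
      trans (cong headIndexNf (nf-ϱ-injR (S Z) (S Z) refl M)) (index-injR Ξ refl)
    headIndex-ϱ (inR (S (S ()))) Ms

    arg-ϱ-injR-injective : ∀ {Bs} (c : Γ₁₁ ∋ one) (h : Δ₁₂ ∋ ty (ty Bs ∷ [])) → ϱ c ≡ viaConst h →
      (M N : Tm (Ξ ++ Δ₁₂) o) → nf (app (extend Ξ ϱ (injR Ξ c)) M) ≡ nf (app (extend Ξ ϱ (injR Ξ c)) N) → M ≈ N
    arg-ϱ-injR-injective {Bs} c h ϱc≡ M N p = embNf-nf-≈⇒≈ (constNf-injective Bs (nf M) (nf N)
      (proj₂ (napp-injective (nne-injective
        (trans (sym (nf-ϱ-injR c h ϱc≡ M)) (trans p (nf-ϱ-injR c h ϱc≡ N)))))))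

    args-ϱ-injective : ∀ {As} {a : (Ξ ++ Γ₁₁) ∋ ty As} → Split Ξ a → (Ms Ns : Args (Ξ ++ Δ₁₂) As) →
      nf (apps (extend Ξ ϱ a) Ms) ≡ nf (apps (extend Ξ ϱ a) Ns) → ArgsEq Ms Ns
    args-ϱ-injective (inL x) Ms Ns p = nfs-≡⇒ArgsEq Ms Ns (proj₂ (napps-injective (nfs Ms) (nfs Ns)
      (nne-injective (trans (sym (nf-ϱ-injL x Ms)) (trans p (nf-ϱ-injL x Ns))))))
    args-ϱ-injective (inR Z) (M ∷ []) (N ∷ []) p = arg-ϱ-injR-injective Z Z refl M N p ∷ []
    args-ϱ-injective (inR (S Z)) (M ∷ []) (N ∷ []) p = arg-ϱ-injR-injective (S Z) (S Z) refl M N p ∷ []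
    args-ϱ-injective (inR (S (S ()))) Ms Ns p

  ϱ-atomic : AtomicReduction ϱ
  ϱ-atomic Ξ a b Ms Ns p
    with index-injective a b (trans (sym (headIndex-ϱ Ξ (split Ξ a) Ms))
                                    (trans (cong headIndexNf (nf-≈ p)) (headIndex-ϱ Ξ (split Ξ b) Ns)))
  ... | same = same , args-ϱ-injective Ξ (split Ξ a) Ms Ns (nf-≈ p)

lemmaL : ∀ (A₁ A₂ : Ty) → Atomic (ty (ty (A₁ ∷ []) ∷ ty (A₂ ∷ []) ∷ []))
lemmaL (ty Bs₁) (ty Bs₂) = ϱ Bs₁ Bs₂ , ϱ-atomic Bs₁ Bs₂
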